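{- The calculus $\mathsf{G}$ (the logic InFL$^-_e$) is decidable: there is an algorithm which, given formulas $\alpha,\beta$, decides whether $\vdash_{\mathsf{G}}\alpha\Rightarrow\beta$.
   Context: Formulas are built from propositional variables by $\alpha\cdot\beta$, $\alpha\backslash\beta$, $\alpha\wedge\beta$, $\alpha\vee\beta$, $\neg\alpha$; sequents are $\alpha\Rightarrow\beta$ with single formulas. The calculus $\mathsf{G}$ has axioms $(\mathrm{Id})\ \alpha\Rightarrow\alpha$ and $(\mathrm{DN2})\ \neg\neg\alpha\Rightarrow\alpha$, and rules (premises / conclusion): $(\mathrm{RES}\backslash)$ $\alpha\cdot\beta\Rightarrow\gamma$ / $\beta\Rightarrow\alpha\backslash\gamma$; $(\mathrm{RES}^-\backslash)$ $\beta\Rightarrow\alpha\backslash\gamma$ / $\alpha\cdot\beta\Rightarrow\gamma$; $(\wedge\mathrm{L})$ $\alpha\Rightarrow\beta$ / $\alpha\wedge\gamma\Rightarrow\beta$ and $\alpha\Rightarrow\beta$ / $\gamma\wedge\alpha\Rightarrow\beta$; $(\wedge\mathrm{R})$ $\alpha\Rightarrow\beta$, $\alpha\Rightarrow\gamma$ / $\alpha\Rightarrow\beta\wedge\gamma$; $(\vee\mathrm{L})$ $\alpha\Rightarrow\beta$, $\gamma\Rightarrow\beta$ / $\alpha\vee\gamma\Rightarrow\beta$; $(\vee\mathrm{R})$ $\alpha\Rightarrow\beta$ / $\alpha\Rightarrow\beta\vee\gamma$ and $\alpha\Rightarrow\beta$ / $\alpha\Rightarrow\gamma\vee\beta$; $(\neg)$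 $\alpha\cdot\beta\Rightarrow\neg\gamma$ / $\gamma\cdot\beta\Rightarrow\neg\alpha$ and its special case $(\mathrm{MN})$ $\alpha\Rightarrow\neg\gamma$ / $\gamma\Rightarrow\neg\alpha$; $(\mathrm{Cut})$ $\alpha\Rightarrow\beta$, $\beta\Rightarrow\gamma$ / $\alpha\Rightarrow\gamma$. -}

module Defs where

open import Data.Nat using (ℕ)

infixr 30 _·_
infixr 25 _\\_
infixr 20 _∧_
infixr 15 _∨_
infix 5 _⇒_
infix 3 ⊢_

data Formula : Set where
  var  : ℕ → Formula
  _·_  : Formula → Formula → Formula
  _\\_ : Formula → Formula → Formula
  _∧_  : Formula → Formula → Formula
  _∨_  : Formula → Formula → Formula
  ~_   : Formula → Formula

data Sequent : Set where
  _⇒_ : Formula → Formula → Sequent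

data ⊢_ : Sequent → Set where
  Id    : ∀ {α} → ⊢ α ⇒ α
  DN2   : ∀ {α} → ⊢ ~ ~ α ⇒ α
  RES\\  : ∀ {α β γ} → ⊢ α · β ⇒ γ → ⊢ β ⇒ α \\ γ
  RES⁻\\ : ∀ {α β γ} → ⊢ β ⇒ α \\ γ → ⊢ α · β ⇒ γ
  ∧L₁   : ∀ {α β γ} → ⊢ α ⇒ β → ⊢ α ∧ γ ⇒ β
  ∧L₂   : ∀ {α β γ} → ⊢ α ⇒ β → ⊢ γ ∧ α ⇒ β
  ∧R    : ∀ {α β γ} → ⊢ α ⇒ β → ⊢ α ⇒ γ → ⊢ α ⇒ β ∧ γ
  ∨L    : ∀ {α β γ} → ⊢ α ⇒ β → ⊢ γ ⇒ β → ⊢ α ∨ γ ⇒ β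
  ∨R₁   : ∀ {α β γ} → ⊢ α ⇒ β → ⊢ α ⇒ β ∨ γ
  ∨R₂   : ∀ {α β γ} → ⊢ α ⇒ β → ⊢ α ⇒ γ ∨ β
  Neg   : ∀ {α β γ} → ⊢ α · β ⇒ ~ γ → ⊢ γ · β ⇒ ~ α
  MN    : ∀ {α γ} → ⊢ α ⇒ ~ γ → ⊢ γ ⇒ ~ α
  Cut   : ∀ {α β γ} → ⊢ α ⇒ β → ⊢ β ⇒ γ → ⊢ α ⇒ γ

-- G is equivalent to a cut-free display calculus in which a structure X ∘ Y
-- stands for a product, X ⊸ Y for a negated residual, and a sequent X ⊩ Y
-- asserts ⟦ X ⟧ ⇒ ~ ⟦ Y ⟧.  Cut is eliminated Belnap-style, by tracing the cut
-- formula up to the places where it is principal.  Read bottom-up, every rule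
-- of the cut-free calculus has finitely many instances concluding a given
-- sequent, keeps the subformula property and never increases the total size of
-- a sequent.  So all sequents relevant to pos α ⊩ neg β lie in a finite
-- universe U, and derivability of height k, which only grows with k inside U,
-- stabilises before height |U| + 1; deciding it at that height decides G.
module Submission where

open import Data.Empty using (⊥)
open import Data.List.Base
  using (List; []; _∷_; [_]; _++_; length; filter; map; cartesianProductWith; cartesianProduct)
open import Data.List.Membership.Propositional using (_∈_; lose)
open import Data.List.Membership.Propositional.Properties
  using (∈-++⁺ˡ; ∈-++⁺ʳ; ∈-map⁺; ∈-cartesianProductWith⁺; ∈-cartesianProduct⁺)
open import Data.List.Properties using (length-filter)
open import Data.List.Relation.Unary.All as All using (All; []; _∷_; all?)
open import Data.List.Relation.Unary.All.Properties using (++⁺)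
open import Data.List.Relation.Unary.Any as Any using (Any; here; there; any?)
open import Data.List.Relation.Unary.Any.Properties using (++⁺ˡ; ++⁺ʳ; ++⁻)
open import Data.Nat.Base using (ℕ; zero; suc; _+_; _⊔_; _≤_; _<_; z≤n; s≤s; s≤s⁻¹)
open import Data.Nat.Properties
  using ( _≟_; ≤-refl; ≤-reflexive; ≤-trans; <-≤-trans; +-comm; +-monoˡ-≤
        ; m≤m+n; m≤n+m; m≤n⇒m≤1+n; n≤1+n; m<m+n; m<n+m; n≮n; m≤m⊔n; m≤n⊔m)
open import Data.Nat.Tactic.RingSolver using (solve-∀)
open import Data.Product.Base using (∃-syntax; _×_; _,_; map₂; uncurry)
open import Data.Sum.Base using (_⊎_; inj₁; inj₂)
open import Level using (0ℓ)
open import Relation.Binary.PropositionalEquality using (_≡_; refl)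
open import Relation.Nullary using (¬_; Dec; yes; no; contradiction)
open import Relation.Nullary.Decidable using (_×-dec_; ¬?; map′)
open import Relation.Unary using (Pred; Decidable; _⊆_)

open import Defs

~~-intro : ∀ {α} → ⊢ α ⇒ ~ ~ α
~~-intro = MN Id

·-monoʳ : ∀ {α β β′} → ⊢ β ⇒ β′ → ⊢ α · β ⇒ α · β′
·-monoʳ p = RES⁻\\ (Cut p (RES\\ Id))

·-monoˡ : ∀ {α α′ β} → ⊢ α ⇒ α′ → ⊢ α · β ⇒ α′ · β
·-monoˡ p = Cut (Neg (Cut (Neg ~~-intro) (MN (Cut p ~~-intro)))) DN2

data Signed : Set where
  pos neg : Formula → Signed

dual : Signed → Signed
dual (pos α) = neg α
dual (neg α) = pos α

infixr 8 _∘_ _⊸_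
infix 4 _⊩_

data Structure : Set where
  leaf : Signed → Structure
  _∘_  : Structure → Structure → Structure
  _⊸_  : Structure → Structure → Structure

-- Identity is postulated only for variables, so that proof search only has to
-- compare variable indices; ⊩-refl recovers it for every formula.
mutual
  data _⊩_ : Structure → Structure → Set where
    ax    : ∀ {n} → leaf (pos (var n)) ⊩ leaf (neg (var n))
    sym   : ∀ {X Y} → X ⊩ Y → Y ⊩ X
    res   : ∀ {X Y Z} → X ∘ Y ⊩ Z → Y ⊩ X ⊸ Z
    unres : ∀ {X Y Z} → Y ⊩ X ⊸ Z → X ∘ Y ⊩ Z
    rot   : ∀ {X Y Z} → X ∘ Y ⊩ Z → Z ∘ Y ⊩ X
    intro : ∀ {B Z} → Principal B Z → leaf B ⊩ Z

  data Principal : Signed → Structure → Set where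
    ·⁺  : ∀ {α β Z} → leaf (pos α) ∘ leaf (pos β) ⊩ Z → Principal (pos (α · β)) Z
    ·⁻  : ∀ {α β X Y} → X ⊩ leaf (neg α) → Y ⊩ leaf (neg β) →
          Principal (neg (α · β)) (X ∘ Y)
    \\⁺ : ∀ {α γ X Z} → X ⊩ leaf (neg α) → leaf (pos γ) ⊩ Z →
          Principal (pos (α \\ γ)) (X ⊸ Z)
    \\⁻ : ∀ {α γ Y} → leaf (pos α) ∘ Y ⊩ leaf (neg γ) → Principal (neg (α \\ γ)) Y
    ~⁺  : ∀ {α Z} → leaf (neg α) ⊩ Z → Principal (pos (~ α)) Z
    ~⁻  : ∀ {α Z} → leaf (pos α) ⊩ Z → Principal (neg (~ α)) Z
    ∧⁺₁ : ∀ {α β Z} → leaf (pos α) ⊩ Z → Principal (pos (α ∧ β)) Z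
    ∧⁺₂ : ∀ {α β Z} → leaf (pos β) ⊩ Z → Principal (pos (α ∧ β)) Z
    ∧⁻  : ∀ {α β Z} → leaf (neg α) ⊩ Z → leaf (neg β) ⊩ Z → Principal (neg (α ∧ β)) Z
    ∨⁺  : ∀ {α β Z} → leaf (pos α) ⊩ Z → leaf (pos β) ⊩ Z → Principal (pos (α ∨ β)) Z
    ∨⁻₁ : ∀ {α β Z} → leaf (neg α) ⊩ Z → Principal (neg (α ∨ β)) Z
    ∨⁻₂ : ∀ {α β Z} → leaf (neg β) ⊩ Z → Principal (neg (α ∨ β)) Z

⟦_⟧ : Structure → Formula
⟦ leaf (pos α) ⟧ = α
⟦ leaf (neg α) ⟧ = ~ α
⟦ X ∘ Y ⟧ = ⟦ X ⟧ · ⟦ Y ⟧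
⟦ X ⊸ Z ⟧ = ~ (⟦ X ⟧ \\ (~ ⟦ Z ⟧))

mutual
  ⊩-sound : ∀ {X Y} → X ⊩ Y → ⊢ ⟦ X ⟧ ⇒ ~ ⟦ Y ⟧
  ⊩-sound ax        = ~~-intro
  ⊩-sound (sym d)   = MN (⊩-sound d)
  ⊩-sound (res d)   = Cut (RES\\ (⊩-sound d)) ~~-intro
  ⊩-sound (unres d) = RES⁻\\ (Cut (⊩-sound d) DN2)
  ⊩-sound (rot d)   = Neg (⊩-sound d)
  ⊩-sound (intro p) = principal-sound p

  principal-sound : ∀ {B Z} → Principal B Z → ⊢ ⟦ leaf B ⟧ ⇒ ~ ⟦ Z ⟧
  principal-sound (·⁺ d) = ⊩-sound d
  principal-sound (·⁻ dx dy) =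
    MN (Cut (Cut (·-monoˡ (Cut (⊩-sound dx) DN2)) (·-monoʳ (Cut (⊩-sound dy) DN2))) ~~-intro)
  principal-sound (\\⁺ dx dz) =
    Cut (RES\\ (Cut (Cut (·-monoˡ (Cut (⊩-sound dx) DN2)) (RES⁻\\ Id)) (⊩-sound dz))) ~~-intro
  principal-sound (\\⁻ d)    = MN (Cut (RES\\ (Cut (⊩-sound d) DN2)) ~~-intro)
  principal-sound (~⁺ d)     = ⊩-sound d
  principal-sound (~⁻ d)     = Cut DN2 (⊩-sound d)
  principal-sound (∧⁺₁ d)    = ∧L₁ (⊩-sound d)
  principal-sound (∧⁺₂ d)    = ∧L₂ (⊩-sound d)
  principal-sound (∧⁻ dα dβ) = MN (Cut (∧R (dual-sound dα) (dual-sound dβ)) ~~-intro)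
  principal-sound (∨⁺ dα dβ) = ∨L (⊩-sound dα) (⊩-sound dβ)
  principal-sound (∨⁻₁ d)    = MN (Cut (∨R₁ (dual-sound d)) ~~-intro)
  principal-sound (∨⁻₂ d)    = MN (Cut (∨R₂ (dual-sound d)) ~~-intro)

  dual-sound : ∀ {α Z} → leaf (neg α) ⊩ Z → ⊢ ⟦ Z ⟧ ⇒ α
  dual-sound d = Cut (MN (⊩-sound d)) DN2

⊩-refl : ∀ α → leaf (pos α) ⊩ leaf (neg α)
⊩-refl (var n) = ax
⊩-refl (α · β) = intro (·⁺ (sym (intro (·⁻ (⊩-refl α) (⊩-refl β)))))
⊩-refl (α \\ γ) = sym (intro (\\⁻ (unres (intro (\\⁺ (⊩-refl α) (⊩-refl γ))))))
⊩-refl (α ∧ β) =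
  sym (intro (∧⁻ (sym (intro (∧⁺₁ (⊩-refl α)))) (sym (intro (∧⁺₂ (⊩-refl β))))))
⊩-refl (α ∨ β) =
  intro (∨⁺ (sym (intro (∨⁻₁ (sym (⊩-refl α))))) (sym (intro (∨⁻₂ (sym (⊩-refl β))))))
⊩-refl (~ α) = intro (~⁺ (sym (intro (~⁻ (⊩-refl α)))))

data Subst (B : Signed) (W : Structure) : Structure → Structure → Set where
  hole : Subst B W (leaf B) W
  ∘ˡ   : ∀ {X X′ Y} → Subst B W X X′ → Subst B W (X ∘ Y) (X′ ∘ Y)
  ∘ʳ   : ∀ {X X′ Y} → Subst B W X X′ → Subst B W (Y ∘ X) (Y ∘ X′)
  ⊸ˡ   : ∀ {X X′ Y} → Subst B W X X′ → Subst B W (X ⊸ Y) (X′ ⊸ Y)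
  ⊸ʳ   : ∀ {X X′ Y} → Subst B W X X′ → Subst B W (Y ⊸ X) (Y ⊸ X′)

Absorbs : Structure → Signed → Set
Absorbs W B = ∀ {Z} → Principal B Z → W ⊩ Z

mutual
  subst-left : ∀ {B W X X′ Y} → W ⊩ leaf (dual B) → Absorbs W B →
               X ⊩ Y → Subst B W X X′ → X′ ⊩ Y
  subst-left e h ax        hole   = e
  subst-left e h (sym d)   s      = sym (subst-right e h d s)
  subst-left e h (res d)   s      = res (subst-left e h d (∘ʳ s))
  subst-left e h (unres d) (∘ˡ s) = unres (subst-right e h d (⊸ˡ s))
  subst-left e h (unres d) (∘ʳ s) = unres (subst-left e h d s)
  subst-left e h (rot d)   (∘ˡ s) = rot (subst-right e h d s)
  subst-left e h (rot d)   (∘ʳ s) = rot (subst-left e h d (∘ʳ s))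
  subst-left e h (intro p) hole   = h p

  subst-right : ∀ {B W X Y Y′} → W ⊩ leaf (dual B) → Absorbs W B →
                X ⊩ Y → Subst B W Y Y′ → X ⊩ Y′
  subst-right e h ax        hole   = sym e
  subst-right e h (sym d)   s      = sym (subst-left e h d s)
  subst-right e h (res d)   (⊸ˡ s) = res (subst-left e h d (∘ˡ s))
  subst-right e h (res d)   (⊸ʳ s) = res (subst-right e h d s)
  subst-right e h (unres d) s      = unres (subst-right e h d (⊸ʳ s))
  subst-right e h (rot d)   s      = rot (subst-left e h d (∘ˡ s))
  subst-right e h (intro p) s      = intro (subst-principal e h p s)

  subst-principal : ∀ {B W C Z Z′} → W ⊩ leaf (dual B) → Absorbs W B →
                    Principal C Z → Subst B W Z Z′ → Principal C Z′
  subst-principal e h (·⁺ d)      s      = ·⁺ (subst-right e h d s)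
  subst-principal e h (·⁻ dx dy)  (∘ˡ s) = ·⁻ (subst-left e h dx s) dy
  subst-principal e h (·⁻ dx dy)  (∘ʳ s) = ·⁻ dx (subst-left e h dy s)
  subst-principal e h (\\⁺ dx dz) (⊸ˡ s) = \\⁺ (subst-left e h dx s) dz
  subst-principal e h (\\⁺ dx dz) (⊸ʳ s) = \\⁺ dx (subst-right e h dz s)
  subst-principal e h (\\⁻ d)     s      = \\⁻ (subst-left e h d (∘ʳ s))
  subst-principal e h (~⁺ d)      s      = ~⁺ (subst-right e h d s)
  subst-principal e h (~⁻ d)      s      = ~⁻ (subst-right e h d s)
  subst-principal e h (∧⁺₁ d)     s      = ∧⁺₁ (subst-right e h d s)
  subst-principal e h (∧⁺₂ d)     s      = ∧⁺₂ (subst-right e h d s)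
  subst-principal e h (∧⁻ dα dβ)  s      = ∧⁻ (subst-right e h dα s) (subst-right e h dβ s)
  subst-principal e h (∨⁺ dα dβ)  s      = ∨⁺ (subst-right e h dα s) (subst-right e h dβ s)
  subst-principal e h (∨⁻₁ d)     s      = ∨⁻₁ (subst-right e h d s)
  subst-principal e h (∨⁻₂ d)     s      = ∨⁻₂ (subst-right e h d s)

data Polarity : Set where
  ⊕ ⊖ : Polarity

signed : Polarity → Formula → Signed
signed ⊕ φ = pos φ
signed ⊖ φ = neg φ

-- Keeping
-- the polarity apart from φ makes the recursion structural in φ; cut-left and
-- cut-right split on it only so that dual (dual B) computes.
mutual
  cut-left : ∀ p φ {X S S′ T} → X ⊩ leaf (signed p φ) → S ⊩ T →
             Subst (dual (signed p φ)) X S S′ → S′ ⊩ T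
  cut-left ⊕ φ d e s = subst-left d (cut-principal ⊕ φ d) e s
  cut-left ⊖ φ d e s = subst-left d (cut-principal ⊖ φ d) e s

  cut-right : ∀ p φ {X S T T′} → X ⊩ leaf (signed p φ) → S ⊩ T →
              Subst (dual (signed p φ)) X T T′ → S ⊩ T′
  cut-right ⊕ φ d e s = subst-right d (cut-principal ⊕ φ d) e s
  cut-right ⊖ φ d e s = subst-right d (cut-principal ⊖ φ d) e s

  cut-principal : ∀ p φ {X} → X ⊩ leaf (signed p φ) → Absorbs X (dual (signed p φ))
  cut-principal p φ d q = subst-right (sym (intro q)) (λ q′ → principal-cut p φ q′ q) d hole

  principal-cut : ∀ p φ {V Z} → Principal (signed p φ) V → Principal (dual (signed p φ)) Z →
                  Z ⊩ V
  principal-cut ⊕ (α · β) (·⁺ d) (·⁻ dx dy) =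
    cut-left ⊖ β dy (cut-left ⊖ α dx d (∘ˡ hole)) (∘ʳ hole)
  principal-cut ⊖ (α · β) (·⁻ dx dy) (·⁺ d) =
    sym (cut-left ⊖ β dy (cut-left ⊖ α dx d (∘ˡ hole)) (∘ʳ hole))
  principal-cut ⊕ (α \\ γ) (\\⁺ dx dz) (\\⁻ d) =
    res (cut-right ⊕ γ (sym dz) (cut-left ⊖ α dx d (∘ˡ hole)) hole)
  principal-cut ⊖ (α \\ γ) (\\⁻ d) (\\⁺ dx dz) =
    sym (res (cut-right ⊕ γ (sym dz) (cut-left ⊖ α dx d (∘ˡ hole)) hole))
  principal-cut ⊕ (~ α)   (~⁺ d)      (~⁻ d′)     = cut-left ⊕ α (sym d′) d hole
  principal-cut ⊖ (~ α)   (~⁻ d)      (~⁺ d′)     = cut-left ⊖ α (sym d′) d hole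
  principal-cut ⊕ (α ∧ β) (∧⁺₁ d)     (∧⁻ dα dβ)  = cut-left ⊖ α (sym dα) d hole
  principal-cut ⊕ (α ∧ β) (∧⁺₂ d)     (∧⁻ dα dβ)  = cut-left ⊖ β (sym dβ) d hole
  principal-cut ⊖ (α ∧ β) (∧⁻ dα dβ)  (∧⁺₁ d)     = cut-left ⊕ α (sym d) dα hole
  principal-cut ⊖ (α ∧ β) (∧⁻ dα dβ)  (∧⁺₂ d)     = cut-left ⊕ β (sym d) dβ hole
  principal-cut ⊕ (α ∨ β) (∨⁺ dα dβ)  (∨⁻₁ d)     = cut-left ⊖ α (sym d) dα hole
  principal-cut ⊕ (α ∨ β) (∨⁺ dα dβ)  (∨⁻₂ d)     = cut-left ⊖ β (sym d) dβ hole
  principal-cut ⊖ (α ∨ β) (∨⁻₁ d)     (∨⁺ dα dβ)  = cut-left ⊕ α (sym dα) d hole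
  principal-cut ⊖ (α ∨ β) (∨⁻₂ d)     (∨⁺ dα dβ)  = cut-left ⊕ β (sym dβ) d hole

⊩-cut : ∀ {α X Y} → X ⊩ leaf (neg α) → leaf (pos α) ⊩ Y → X ⊩ Y
⊩-cut {α} d e = cut-left ⊖ α d e hole

·⁺-inv : ∀ {α β Z} → leaf (pos (α · β)) ⊩ Z → leaf (pos α) ∘ leaf (pos β) ⊩ Z
·⁺-inv e = ⊩-cut (sym (intro (·⁻ (⊩-refl _) (⊩-refl _)))) e

~⁻-inv : ∀ {γ X} → X ⊩ leaf (neg (~ γ)) → X ⊩ leaf (pos γ)
~⁻-inv {γ} d = cut-right ⊕ (~ γ) (sym (intro (~⁺ (sym (⊩-refl γ))))) d hole

⊢⇒⊩ : ∀ {α β} → ⊢ α ⇒ β → leaf (pos α) ⊩ leaf (neg β)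
⊢⇒⊩ Id          = ⊩-refl _
⊢⇒⊩ DN2         = intro (~⁺ (intro (~⁻ (⊩-refl _))))
⊢⇒⊩ (RES\\ p)   = sym (intro (\\⁻ (·⁺-inv (⊢⇒⊩ p))))
⊢⇒⊩ (RES⁻\\ p)  =
  intro (·⁺ (unres (⊩-cut (⊢⇒⊩ p) (intro (\\⁺ (⊩-refl _) (⊩-refl _))))))
⊢⇒⊩ (∧L₁ p)     = intro (∧⁺₁ (⊢⇒⊩ p))
⊢⇒⊩ (∧L₂ p)     = intro (∧⁺₂ (⊢⇒⊩ p))
⊢⇒⊩ (∧R p q)    = sym (intro (∧⁻ (sym (⊢⇒⊩ p)) (sym (⊢⇒⊩ q))))
⊢⇒⊩ (∨L p q)    = intro (∨⁺ (⊢⇒⊩ p) (⊢⇒⊩ q))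
⊢⇒⊩ (∨R₁ p)     = sym (intro (∨⁻₁ (sym (⊢⇒⊩ p))))
⊢⇒⊩ (∨R₂ p)     = sym (intro (∨⁻₂ (sym (⊢⇒⊩ p))))
⊢⇒⊩ (Neg p)     = intro (·⁺ (sym (intro (~⁻ (sym (rot (~⁻-inv (·⁺-inv (⊢⇒⊩ p)))))))))
⊢⇒⊩ (MN p)      = sym (intro (~⁻ (~⁻-inv (⊢⇒⊩ p))))
⊢⇒⊩ (Cut p q)   = ⊩-cut (⊢⇒⊩ p) (⊢⇒⊩ q)

⊩⇒⊢ : ∀ {α β} → leaf (pos α) ⊩ leaf (neg β) → ⊢ α ⇒ β
⊩⇒⊢ d = Cut (⊩-sound d) DN2

module _ {a p q} {A : Set a} {P : Pred A p} {Q : Pred A q}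
         (P? : Decidable P) (Q? : Decidable Q) (P⊆Q : P ⊆ Q) where

  length-filter-mono : ∀ xs → length (filter P? xs) ≤ length (filter Q? xs)
  length-filter-mono []       = z≤n
  length-filter-mono (x ∷ xs) with P? x | Q? x
  ... | yes _  | yes _  = s≤s (length-filter-mono xs)
  ... | yes px | no ¬qx = contradiction (P⊆Q px) ¬qx
  ... | no _   | yes _  = m≤n⇒m≤1+n (length-filter-mono xs)
  ... | no _   | no _   = length-filter-mono xs

  length-filter-strict : ∀ {xs} → Any (λ x → Q x × ¬ P x) xs →
                         length (filter P? xs) < length (filter Q? xs)
  length-filter-strict {x ∷ xs} (here (qx , ¬px)) with P? x | Q? x
  ... | yes px | _      = contradiction px ¬px
  ... | no _   | yes _  = s≤s (length-filter-mono xs)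
  ... | no _   | no ¬qx = contradiction qx ¬qx
  length-filter-strict {x ∷ xs} (there any) with P? x | Q? x
  ... | yes _  | yes _  = s≤s (length-filter-strict any)
  ... | yes px | no ¬qx = contradiction (P⊆Q px) ¬qx
  ... | no _   | yes _  = m≤n⇒m≤1+n (length-filter-strict any)
  ... | no _   | no _   = length-filter-strict any

module BoundedSearch {S : Set} (rules : S → List (List S)) where

  Derivable≤ : ℕ → S → Set
  Derivable≤ zero    s = ⊥
  Derivable≤ (suc k) s = Any (All (Derivable≤ k)) (rules s)

  Derivable : S → Set
  Derivable s = ∃[ k ] Derivable≤ k s

  derivable≤? : ∀ k → Decidable (Derivable≤ k)
  derivable≤? zero    s = no λ ()
  derivable≤? (suc k) s = any? (all? (derivable≤? k)) (rules s)

  derivable≤-mono : ∀ {k m} → k ≤ m → Derivable≤ k ⊆ Derivable≤ m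
  derivable≤-mono {suc k} {suc m} (s≤s k≤m) = Any.map (All.map (derivable≤-mono k≤m))

  module _ (Good : Pred S 0ℓ) (universe : List S) (good∈universe : Good ⊆ (_∈ universe))
           (rules-good : ∀ {s} → Good s → All (All Good) (rules s)) where

    Saturated : ℕ → Set
    Saturated k = ∀ {s} → Good s → Derivable≤ (suc k) s → Derivable≤ k s

    saturated-absorbs : ∀ {k} → Saturated k →
                        ∀ j {s} → Good s → Derivable≤ j s → Derivable≤ k s
    saturated-absorbs sat (suc j) g d = sat g (some-rule (rules-good g) d)
      where
      some-rule : ∀ {rs} → All (All Good) rs → Any (All (Derivable≤ j)) rs →
                  Any (All (Derivable≤ _)) rs
      some-rule (gs ∷ _)   (here ds)  =
        here (All.zipWith (λ (g , d) → saturated-absorbs sat j g d) (gs , ds))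
      some-rule (_ ∷ gss)  (there ds) = there (some-rule gss ds)

    reached : ℕ → ℕ
    reached k = length (filter (derivable≤? k) universe)

    saturated-or-grows : ∀ k → Saturated k ⊎ reached k < reached (suc k)
    saturated-or-grows k
      with any? (λ s → derivable≤? (suc k) s ×-dec ¬? (derivable≤? k s)) universe
    ... | yes new = inj₂ (length-filter-strict (derivable≤? k) (derivable≤? (suc k))
                                               (derivable≤-mono (n≤1+n k)) new)
    ... | no none = inj₁ λ {s} g d → old-or-new g d (derivable≤? k s)
      where
      old-or-new : ∀ {s} → Good s → Derivable≤ (suc k) s →
                   Dec (Derivable≤ k s) → Derivable≤ k s
      old-or-new _ _ (yes old) = old
      old-or-new g d (no ¬old) = contradiction (lose (good∈universe g) (d , ¬old)) none

    saturated-or-large : ∀ k → (∃[ j ] j ≤ k × Saturated j) ⊎ k ≤ reached k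
    saturated-or-large zero = inj₂ z≤n
    saturated-or-large (suc k) with saturated-or-large k
    ... | inj₁ (j , j≤k , sat) = inj₁ (j , m≤n⇒m≤1+n j≤k , sat)
    ... | inj₂ k≤reached with saturated-or-grows k
    ...   | inj₁ sat  = inj₁ (k , n≤1+n k , sat)
    ...   | inj₂ grow = inj₂ (≤-trans (s≤s k≤reached) grow)

    bound : ℕ
    bound = suc (length universe)

    saturated-below-bound : ∃[ j ] j ≤ bound × Saturated j
    saturated-below-bound with saturated-or-large bound
    ... | inj₁ sat = sat
    ... | inj₂ big = contradiction (≤-trans big (length-filter (derivable≤? bound) universe))
                                   (n≮n (length universe))

    derivable⇒derivable≤bound : ∀ {s} → Good s → Derivable s → Derivable≤ bound s
    derivable⇒derivable≤bound g (k , d) with saturated-below-bound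
    ... | j , j≤bound , sat = derivable≤-mono j≤bound (saturated-absorbs sat k g d)

    derivable? : ∀ {s} → Good s → Dec (Derivable s)
    derivable? {s} g = map′ (bound ,_) (derivable⇒derivable≤bound g) (derivable≤? bound s)

Sequentᴰ : Set
Sequentᴰ = Structure × Structure

axiom : ℕ → Structure → List (List Sequentᴰ)
axiom m (leaf (neg (var n))) with m ≟ n
... | yes _ = [ [] ]
... | no _  = []
axiom _ _ = []

logical : Signed → Structure → List (List Sequentᴰ)
logical (pos (var m))   Z       = axiom m Z
logical (neg (var _))   _       = []
logical (pos (α · β))   Z       = [ [ leaf (pos α) ∘ leaf (pos β) , Z ] ]
logical (neg (α · β))   (X ∘ Y) = [ (X , leaf (neg α)) ∷ (Y , leaf (neg β)) ∷ [] ]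
logical (neg (α · β))   _       = []
logical (pos (α \\ γ))  (X ⊸ Z) = [ (X , leaf (neg α)) ∷ (leaf (pos γ) , Z) ∷ [] ]
logical (pos (α \\ γ))  _       = []
logical (neg (α \\ γ))  Y       = [ [ leaf (pos α) ∘ Y , leaf (neg γ) ] ]
logical (pos (~ α))     Z       = [ [ leaf (neg α) , Z ] ]
logical (neg (~ α))     Z       = [ [ leaf (pos α) , Z ] ]
logical (pos (α ∧ β))   Z       = [ leaf (pos α) , Z ] ∷ [ leaf (pos β) , Z ] ∷ []
logical (neg (α ∧ β))   Z       = [ (leaf (neg α) , Z) ∷ (leaf (neg β) , Z) ∷ [] ]
logical (pos (α ∨ β))   Z       = [ (leaf (pos α) , Z) ∷ (leaf (pos β) , Z) ∷ [] ]
logical (neg (α ∨ β))   Z       = [ leaf (neg α) , Z ] ∷ [ leaf (neg β) , Z ] ∷ []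

leftRules : Structure → Structure → List (List Sequentᴰ)
leftRules (leaf B) Z = logical B Z
leftRules (X ∘ Y)  Z = [ Y , X ⊸ Z ] ∷ [ Z ∘ Y , X ] ∷ []
leftRules (_ ⊸ _)  _ = []

rightRules : Structure → Structure → List (List Sequentᴰ)
rightRules Y (X ⊸ Z) = [ [ X ∘ Y , Z ] ]
rightRules _ _       = []

rules : Sequentᴰ → List (List Sequentᴰ)
rules (X , Y) = [ Y , X ] ∷ leftRules X Y ++ rightRules X Y

open BoundedSearch rules public

Provable : Sequentᴰ → Set
Provable (X , Y) = X ⊩ Y

logical-sound : ∀ B Z → Any (All Provable) (logical B Z) → leaf B ⊩ Z
logical-sound (pos (var m)) (leaf (neg (var n))) r with m ≟ n
logical-sound (pos (var m)) (leaf (neg (var m))) _ | yes refl = ax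
logical-sound (pos (α · β))  Z       (here (d ∷ []))                = intro (·⁺ d)
logical-sound (neg (α · β))  (X ∘ Y) (here (dx ∷ dy ∷ []))          = intro (·⁻ dx dy)
logical-sound (pos (α \\ γ)) (X ⊸ Z) (here (dx ∷ dz ∷ []))          = intro (\\⁺ dx dz)
logical-sound (neg (α \\ γ)) Y       (here (d ∷ []))                = intro (\\⁻ d)
logical-sound (pos (~ α))    Z       (here (d ∷ []))                = intro (~⁺ d)
logical-sound (neg (~ α))    Z       (here (d ∷ []))                = intro (~⁻ d)
logical-sound (pos (α ∧ β))  Z       (here (d ∷ []))                = intro (∧⁺₁ d)
logical-sound (pos (α ∧ β))  Z       (there (here (d ∷ [])))        = intro (∧⁺₂ d)
logical-sound (neg (α ∧ β))  Z       (here (dα ∷ dβ ∷ []))          = intro (∧⁻ dα dβ)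
logical-sound (pos (α ∨ β))  Z       (here (dα ∷ dβ ∷ []))          = intro (∨⁺ dα dβ)
logical-sound (neg (α ∨ β))  Z       (here (d ∷ []))                = intro (∨⁻₁ d)
logical-sound (neg (α ∨ β))  Z       (there (here (d ∷ [])))        = intro (∨⁻₂ d)

leftRules-sound : ∀ X Y → Any (All Provable) (leftRules X Y) → X ⊩ Y
leftRules-sound (leaf B) Z r                      = logical-sound B Z r
leftRules-sound (X ∘ Y)  Z (here (d ∷ []))        = unres d
leftRules-sound (X ∘ Y)  Z (there (here (d ∷ []))) = rot d

rightRules-sound : ∀ X Y → Any (All Provable) (rightRules X Y) → X ⊩ Y
rightRules-sound Y (X ⊸ Z) (here (d ∷ [])) = res d

rules-sound : ∀ {s} → Any (All Provable) (rules s) → Provable s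
rules-sound             (here (d ∷ [])) = sym d
rules-sound {X , Y} (there r) with ++⁻ (leftRules X Y) r
... | inj₁ l = leftRules-sound X Y l
... | inj₂ r = rightRules-sound X Y r

derivable≤⇒provable : ∀ k {s} → Derivable≤ k s → Provable s
derivable≤⇒provable (suc k) d = rules-sound (Any.map (All.map (derivable≤⇒provable k)) d)

axiom-refl : ∀ {P : Sequentᴰ → Set} n → Any (All P) (axiom n (leaf (neg (var n))))
axiom-refl n with n ≟ n
... | yes _   = here []
... | no n≢n = contradiction refl n≢n

axiom-premise-free : ∀ {P : Sequentᴰ → Set} m Z → All (All P) (axiom m Z)
axiom-premise-free m (leaf (neg (var n))) with m ≟ n
... | yes _ = [] ∷ []
... | no _  = []
axiom-premise-free m (leaf (pos _))       = []
axiom-premise-free m (leaf (neg (_ · _)))  = []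
axiom-premise-free m (leaf (neg (_ \\ _))) = []
axiom-premise-free m (leaf (neg (_ ∧ _)))  = []
axiom-premise-free m (leaf (neg (_ ∨ _)))  = []
axiom-premise-free m (leaf (neg (~ _)))    = []
axiom-premise-free m (_ ∘ _)               = []
axiom-premise-free m (_ ⊸ _)               = []

DerivableVia : List (List Sequentᴰ) → Set
DerivableVia rs = ∃[ k ] Any (All (Derivable≤ k)) rs

one-premise : ∀ {s rs} → Derivable s → DerivableVia ([ s ] ∷ rs)
one-premise (k , d) = k , here (d ∷ [])

two-premises : ∀ {s t rs} → Derivable s → Derivable t → DerivableVia ((s ∷ t ∷ []) ∷ rs)
two-premises (k , ds) (m , dt) =
  k ⊔ m , here (derivable≤-mono (m≤m⊔n k m) ds ∷ derivable≤-mono (m≤n⊔m k m) dt ∷ [])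

another : ∀ {r rs} → DerivableVia rs → DerivableVia (r ∷ rs)
another = map₂ there

by-sym : ∀ {X Y} → Derivable (Y , X) → Derivable (X , Y)
by-sym (k , d) = suc k , here (d ∷ [])

by-left : ∀ {X Y} → DerivableVia (leftRules X Y) → Derivable (X , Y)
by-left (k , r) = suc k , there (++⁺ˡ r)

by-right : ∀ {X Y} → DerivableVia (rightRules X Y) → Derivable (X , Y)
by-right {X} (k , r) = suc k , there (++⁺ʳ (leftRules X _) r)

mutual
  provable⇒derivable : ∀ {X Y} → X ⊩ Y → Derivable (X , Y)
  provable⇒derivable (ax {n})  = by-left (0 , axiom-refl n)
  provable⇒derivable (sym d)   = by-sym (provable⇒derivable d)
  provable⇒derivable (res d)   = by-right (one-premise (provable⇒derivable d))
  provable⇒derivable (unres d) = by-left (one-premise (provable⇒derivable d))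
  provable⇒derivable (rot d)   = by-left (another (one-premise (provable⇒derivable d)))
  provable⇒derivable (intro p) = by-left (principal⇒derivable p)

  principal⇒derivable : ∀ {B Z} → Principal B Z → DerivableVia (logical B Z)
  principal⇒derivable (·⁺ d)      = one-premise (provable⇒derivable d)
  principal⇒derivable (·⁻ dx dy)  = two-premises (provable⇒derivable dx) (provable⇒derivable dy)
  principal⇒derivable (\\⁺ dx dz) = two-premises (provable⇒derivable dx) (provable⇒derivable dz)
  principal⇒derivable (\\⁻ d)     = one-premise (provable⇒derivable d)
  principal⇒derivable (~⁺ d)      = one-premise (provable⇒derivable d)
  principal⇒derivable (~⁻ d)      = one-premise (provable⇒derivable d)
  principal⇒derivable (∧⁺₁ d)     = one-premise (provable⇒derivable d)
  principal⇒derivable (∧⁺₂ d)     = another (one-premise (provable⇒derivable d))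
  principal⇒derivable (∧⁻ dα dβ)  = two-premises (provable⇒derivable dα) (provable⇒derivable dβ)
  principal⇒derivable (∨⁺ dα dβ)  = two-premises (provable⇒derivable dα) (provable⇒derivable dβ)
  principal⇒derivable (∨⁻₁ d)     = one-premise (provable⇒derivable d)
  principal⇒derivable (∨⁻₂ d)     = another (one-premise (provable⇒derivable d))

m+k≡n⇒m≤n : ∀ {m n} k → m + k ≡ n → m ≤ n
m+k≡n⇒m≤n {m} k refl = m≤m+n m k

x+a≤[1+a+b]+[x+y] : ∀ a b x y → x + a ≤ suc (a + b) + (x + y)
x+a≤[1+a+b]+[x+y] a b x y = m+k≡n⇒m≤n (suc (b + y)) (eq a b x y)
  where eq : ∀ a b x y → x + a + suc (b + y) ≡ suc (a + b) + (x + y)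
        eq = solve-∀

y+b≤[1+a+b]+[x+y] : ∀ a b x y → y + b ≤ suc (a + b) + (x + y)
y+b≤[1+a+b]+[x+y] a b x y = m+k≡n⇒m≤n (suc (a + x)) (eq a b x y)
  where eq : ∀ a b x y → y + b + suc (a + x) ≡ suc (a + b) + (x + y)
        eq = solve-∀

a+y+c≤[1+a+c]+y : ∀ a c y → a + y + c ≤ suc (a + c) + y
a+y+c≤[1+a+c]+y a c y = m+k≡n⇒m≤n 1 (eq a c y)
  where eq : ∀ a c y → a + y + c + 1 ≡ suc (a + c) + y
        eq = solve-∀

m+n≤1+o⇒m≤o : ∀ m {n o} → 0 < n → m + n ≤ suc o → m ≤ o
m+n≤1+o⇒m≤o m 0<n m+n≤1+o = s≤s⁻¹ (<-≤-trans (m<m+n m 0<n) m+n≤1+o)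

m+n≤1+o⇒n≤o : ∀ {m} n {o} → 0 < m → m + n ≤ suc o → n ≤ o
m+n≤1+o⇒n≤o n 0<m m+n≤1+o = s≤s⁻¹ (<-≤-trans (m<n+m n 0<m) m+n≤1+o)

size : Formula → ℕ
size (var _)  = 1
size (α · β)  = suc (size α + size β)
size (α \\ β) = suc (size α + size β)
size (α ∧ β)  = suc (size α + size β)
size (α ∨ β)  = suc (size α + size β)
size (~ α)    = suc (size α)

formula : Signed → Formula
formula (pos α) = α
formula (neg α) = α

weight : Structure → ℕ
weight (leaf B) = size (formula B)
weight (X ∘ Y)  = weight X + weight Y
weight (X ⊸ Y)  = weight X + weight Y

‖_‖ : Sequentᴰ → ℕ
‖ X , Y ‖ = weight X + weight Y

size-pos : ∀ φ → 0 < size φ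
size-pos (var _)  = s≤s z≤n
size-pos (_ · _)  = s≤s z≤n
size-pos (_ \\ _) = s≤s z≤n
size-pos (_ ∧ _)  = s≤s z≤n
size-pos (_ ∨ _)  = s≤s z≤n
size-pos (~ _)    = s≤s z≤n

weight-pos : ∀ X → 0 < weight X
weight-pos (leaf B) = size-pos (formula B)
weight-pos (X ∘ Y)  = <-≤-trans (weight-pos X) (m≤m+n _ _)
weight-pos (X ⊸ Y)  = <-≤-trans (weight-pos X) (m≤m+n _ _)

child₁-lighter : ∀ α β Z → size α + weight Z ≤ suc (size α + size β) + weight Z
child₁-lighter α β Z = +-monoˡ-≤ (weight Z) (m≤n⇒m≤1+n (m≤m+n (size α) (size β)))

child₂-lighter : ∀ α β Z → size β + weight Z ≤ suc (size α + size β) + weight Z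
child₂-lighter α β Z = +-monoˡ-≤ (weight Z) (m≤n⇒m≤1+n (m≤n+m (size β) (size α)))

Lighter : ℕ → List (List Sequentᴰ) → Set
Lighter w = All (All (λ p → ‖ p ‖ ≤ w))

logical-lighter : ∀ B Z → Lighter (weight (leaf B) + weight Z) (logical B Z)
logical-lighter (pos (var m))  Z        = axiom-premise-free m Z
logical-lighter (neg (var _))  Z        = []
logical-lighter (pos (α · β))  Z        = (+-monoˡ-≤ (weight Z) (n≤1+n _) ∷ []) ∷ []
logical-lighter (neg (α · β))  (X ∘ Y)  =
  (x+a≤[1+a+b]+[x+y] (size α) (size β) (weight X) (weight Y) ∷
   y+b≤[1+a+b]+[x+y] (size α) (size β) (weight X) (weight Y) ∷ []) ∷ []
logical-lighter (neg (α · β))  (leaf _) = []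
logical-lighter (neg (α · β))  (_ ⊸ _)  = []
logical-lighter (pos (α \\ γ)) (X ⊸ Z)  =
  (x+a≤[1+a+b]+[x+y] (size α) (size γ) (weight X) (weight Z) ∷
   ≤-trans (≤-reflexive (+-comm (size γ) (weight Z)))
           (y+b≤[1+a+b]+[x+y] (size α) (size γ) (weight X) (weight Z)) ∷ []) ∷ []
logical-lighter (pos (α \\ γ)) (leaf _) = []
logical-lighter (pos (α \\ γ)) (_ ∘ _)  = []
logical-lighter (neg (α \\ γ)) Y        = (a+y+c≤[1+a+c]+y (size α) (size γ) (weight Y) ∷ []) ∷ []
logical-lighter (pos (~ α))    Z        = (+-monoˡ-≤ (weight Z) (n≤1+n _) ∷ []) ∷ []
logical-lighter (neg (~ α))    Z        = (+-monoˡ-≤ (weight Z) (n≤1+n _) ∷ []) ∷ []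
logical-lighter (pos (α ∧ β))  Z        =
  (child₁-lighter α β Z ∷ []) ∷ (child₂-lighter α β Z ∷ []) ∷ []
logical-lighter (neg (α ∧ β))  Z        = (child₁-lighter α β Z ∷ child₂-lighter α β Z ∷ []) ∷ []
logical-lighter (pos (α ∨ β))  Z        = (child₁-lighter α β Z ∷ child₂-lighter α β Z ∷ []) ∷ []
logical-lighter (neg (α ∨ β))  Z        =
  (child₁-lighter α β Z ∷ []) ∷ (child₂-lighter α β Z ∷ []) ∷ []

leftRules-lighter : ∀ X Y → Lighter ‖ X , Y ‖ (leftRules X Y)
leftRules-lighter (leaf B) Z = logical-lighter B Z
leftRules-lighter (X ∘ Y)  Z =
  (≤-reflexive (unres-eq (weight X) (weight Y) (weight Z)) ∷ []) ∷
  (≤-reflexive (rot-eq (weight X) (weight Y) (weight Z)) ∷ []) ∷ []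
  where
  unres-eq : ∀ x y z → y + (x + z) ≡ x + y + z
  unres-eq = solve-∀
  rot-eq : ∀ x y z → z + y + x ≡ x + y + z
  rot-eq = solve-∀
leftRules-lighter (_ ⊸ _)  _ = []

rightRules-lighter : ∀ X Y → Lighter ‖ X , Y ‖ (rightRules X Y)
rightRules-lighter Y (X ⊸ Z)  = (≤-reflexive (res-eq (weight X) (weight Y) (weight Z)) ∷ []) ∷ []
  where
  res-eq : ∀ x y z → x + y + z ≡ y + (x + z)
  res-eq = solve-∀
rightRules-lighter _ (leaf _) = []
rightRules-lighter _ (_ ∘ _)  = []

rules-lighter : ∀ s → Lighter ‖ s ‖ (rules s)
rules-lighter (X , Y) =
  (≤-reflexive (+-comm (weight Y) (weight X)) ∷ []) ∷
  ++⁺ (leftRules-lighter X Y) (rightRules-lighter X Y)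

infix 4 _⊑_

data _⊑_ (ψ : Formula) : Formula → Set where
  ⊑-refl : ψ ⊑ ψ
  ⊑·ˡ    : ∀ {α β} → ψ ⊑ α → ψ ⊑ α · β
  ⊑·ʳ    : ∀ {α β} → ψ ⊑ β → ψ ⊑ α · β
  ⊑\\ˡ   : ∀ {α β} → ψ ⊑ α → ψ ⊑ α \\ β
  ⊑\\ʳ   : ∀ {α β} → ψ ⊑ β → ψ ⊑ α \\ β
  ⊑∧ˡ    : ∀ {α β} → ψ ⊑ α → ψ ⊑ α ∧ β
  ⊑∧ʳ    : ∀ {α β} → ψ ⊑ β → ψ ⊑ α ∧ β
  ⊑∨ˡ    : ∀ {α β} → ψ ⊑ α → ψ ⊑ α ∨ β
  ⊑∨ʳ    : ∀ {α β} → ψ ⊑ β → ψ ⊑ α ∨ β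
  ⊑~     : ∀ {α} → ψ ⊑ α → ψ ⊑ ~ α

⊑-trans : ∀ {ψ φ ρ} → ψ ⊑ φ → φ ⊑ ρ → ψ ⊑ ρ
⊑-trans p ⊑-refl   = p
⊑-trans p (⊑·ˡ q)  = ⊑·ˡ (⊑-trans p q)
⊑-trans p (⊑·ʳ q)  = ⊑·ʳ (⊑-trans p q)
⊑-trans p (⊑\\ˡ q) = ⊑\\ˡ (⊑-trans p q)
⊑-trans p (⊑\\ʳ q) = ⊑\\ʳ (⊑-trans p q)
⊑-trans p (⊑∧ˡ q)  = ⊑∧ˡ (⊑-trans p q)
⊑-trans p (⊑∧ʳ q)  = ⊑∧ʳ (⊑-trans p q)
⊑-trans p (⊑∨ˡ q)  = ⊑∨ˡ (⊑-trans p q)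
⊑-trans p (⊑∨ʳ q)  = ⊑∨ʳ (⊑-trans p q)
⊑-trans p (⊑~ q)   = ⊑~ (⊑-trans p q)

⊑-child : ∀ {α φ ρ} → (∀ {ψ} → ψ ⊑ α → ψ ⊑ φ) → φ ⊑ ρ → α ⊑ ρ
⊑-child c p = ⊑-trans (c ⊑-refl) p

mutual
  subformulas : Formula → List Formula
  subformulas φ = φ ∷ properSubformulas φ

  properSubformulas : Formula → List Formula
  properSubformulas (var _)  = []
  properSubformulas (α · β)  = subformulas α ++ subformulas β
  properSubformulas (α \\ β) = subformulas α ++ subformulas β
  properSubformulas (α ∧ β)  = subformulas α ++ subformulas β
  properSubformulas (α ∨ β)  = subformulas α ++ subformulas β
  properSubformulas (~ α)    = subformulas α

⊑⇒∈-subformulas : ∀ {ψ φ} → ψ ⊑ φ → ψ ∈ subformulas φ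
⊑⇒∈-subformulas ⊑-refl   = here refl
⊑⇒∈-subformulas (⊑·ˡ p)  = there (∈-++⁺ˡ (⊑⇒∈-subformulas p))
⊑⇒∈-subformulas (⊑·ʳ {α} p) = there (∈-++⁺ʳ (subformulas α) (⊑⇒∈-subformulas p))
⊑⇒∈-subformulas (⊑\\ˡ p) = there (∈-++⁺ˡ (⊑⇒∈-subformulas p))
⊑⇒∈-subformulas (⊑\\ʳ {α} p) = there (∈-++⁺ʳ (subformulas α) (⊑⇒∈-subformulas p))
⊑⇒∈-subformulas (⊑∧ˡ p)  = there (∈-++⁺ˡ (⊑⇒∈-subformulas p))
⊑⇒∈-subformulas (⊑∧ʳ {α} p) = there (∈-++⁺ʳ (subformulas α) (⊑⇒∈-subformulas p))
⊑⇒∈-subformulas (⊑∨ˡ p)  = there (∈-++⁺ˡ (⊑⇒∈-subformulas p))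
⊑⇒∈-subformulas (⊑∨ʳ {α} p) = there (∈-++⁺ʳ (subformulas α) (⊑⇒∈-subformulas p))
⊑⇒∈-subformulas (⊑~ p)   = there (⊑⇒∈-subformulas p)

Leaves : (Formula → Set) → Structure → Set
Leaves P (leaf B) = P (formula B)
Leaves P (X ∘ Y)  = Leaves P X × Leaves P Y
Leaves P (X ⊸ Y)  = Leaves P X × Leaves P Y

leaves-map : ∀ {P Q : Formula → Set} → (∀ {φ} → P φ → Q φ) →
             ∀ X → Leaves P X → Leaves Q X
leaves-map f (leaf B) p       = f p
leaves-map f (X ∘ Y)  (p , q) = leaves-map f X p , leaves-map f Y q
leaves-map f (X ⊸ Y)  (p , q) = leaves-map f X p , leaves-map f Y q

Within : Formula → Sequentᴰ → Set
Within ρ (X , Y) = Leaves (_⊑ ρ) X × Leaves (_⊑ ρ) Y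

logical-within : ∀ {ρ} B Z → formula B ⊑ ρ → Leaves (_⊑ ρ) Z →
                 All (All (Within ρ)) (logical B Z)
logical-within (pos (var m))  Z        _ _       = axiom-premise-free m Z
logical-within (neg (var _))  Z        _ _       = []
logical-within (pos (α · β))  Z        p z       =
  (((⊑-child ⊑·ˡ p , ⊑-child ⊑·ʳ p) , z) ∷ []) ∷ []
logical-within (neg (α · β))  (X ∘ Y)  p (x , y) =
  ((x , ⊑-child ⊑·ˡ p) ∷ (y , ⊑-child ⊑·ʳ p) ∷ []) ∷ []
logical-within (neg (α · β))  (leaf _) _ _       = []
logical-within (neg (α · β))  (_ ⊸ _)  _ _       = []
logical-within (pos (α \\ γ)) (X ⊸ Z)  p (x , z) =
  ((x , ⊑-child ⊑\\ˡ p) ∷ (⊑-child ⊑\\ʳ p , z) ∷ []) ∷ []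
logical-within (pos (α \\ γ)) (leaf _) _ _       = []
logical-within (pos (α \\ γ)) (_ ∘ _)  _ _       = []
logical-within (neg (α \\ γ)) Y        p y       =
  (((⊑-child ⊑\\ˡ p , y) , ⊑-child ⊑\\ʳ p) ∷ []) ∷ []
logical-within (pos (~ α))    Z        p z       = ((⊑-child ⊑~ p , z) ∷ []) ∷ []
logical-within (neg (~ α))    Z        p z       = ((⊑-child ⊑~ p , z) ∷ []) ∷ []
logical-within (pos (α ∧ β))  Z        p z       =
  ((⊑-child ⊑∧ˡ p , z) ∷ []) ∷ ((⊑-child ⊑∧ʳ p , z) ∷ []) ∷ []
logical-within (neg (α ∧ β))  Z        p z       =
  ((⊑-child ⊑∧ˡ p , z) ∷ (⊑-child ⊑∧ʳ p , z) ∷ []) ∷ []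
logical-within (pos (α ∨ β))  Z        p z       =
  ((⊑-child ⊑∨ˡ p , z) ∷ (⊑-child ⊑∨ʳ p , z) ∷ []) ∷ []
logical-within (neg (α ∨ β))  Z        p z       =
  ((⊑-child ⊑∨ˡ p , z) ∷ []) ∷ ((⊑-child ⊑∨ʳ p , z) ∷ []) ∷ []

leftRules-within : ∀ {ρ} X Y → Within ρ (X , Y) → All (All (Within ρ)) (leftRules X Y)
leftRules-within (leaf B) Z (p , z)       = logical-within B Z p z
leftRules-within (X ∘ Y)  Z ((x , y) , z) = ((y , x , z) ∷ []) ∷ (((z , y) , x) ∷ []) ∷ []
leftRules-within (_ ⊸ _)  _ _             = []

rightRules-within : ∀ {ρ} X Y → Within ρ (X , Y) → All (All (Within ρ)) (rightRules X Y)
rightRules-within Y (X ⊸ Z)  (y , x , z) = (((x , y) , z) ∷ []) ∷ []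
rightRules-within _ (leaf _) _           = []
rightRules-within _ (_ ∘ _)  _           = []

rules-within : ∀ {ρ} s → Within ρ s → All (All (Within ρ)) (rules s)
rules-within (X , Y) xy@(x , y) =
  ((y , x) ∷ []) ∷ ++⁺ (leftRules-within X Y xy) (rightRules-within X Y xy)

Good : Formula → ℕ → Sequentᴰ → Set
Good ρ w s = ‖ s ‖ ≤ w × Within ρ s

rules-good : ∀ {ρ w s} → Good ρ w s → All (All (Good ρ w)) (rules s)
rules-good {s = s} (s≤w , within) =
  All.zipWith (All.zipWith λ (p≤s , p-within) → ≤-trans p≤s s≤w , p-within)
              (rules-lighter s , rules-within s within)

leafStructures : List Formula → List Structure
leafStructures φs = map leaf (map pos φs ++ map neg φs)

joins : (Structure → Structure → Structure) → List Structure → List Structure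
joins _•_ Xs = cartesianProductWith _•_ Xs Xs

structures : List Formula → ℕ → List Structure
structures φs zero    = []
structures φs (suc n) =
  leafStructures φs ++ joins _∘_ (structures φs n) ++ joins _⊸_ (structures φs n)

mutual
  ∈-structures : ∀ {φs} n X → weight X ≤ n → Leaves (_∈ φs) X → X ∈ structures φs n
  ∈-structures zero X X≤0 _ = contradiction (<-≤-trans (weight-pos X) X≤0) (n≮n 0)
  ∈-structures (suc n) (leaf (pos α)) _ α∈ =
    ∈-++⁺ˡ (∈-map⁺ leaf (∈-++⁺ˡ (∈-map⁺ pos α∈)))
  ∈-structures {φs} (suc n) (leaf (neg α)) _ α∈ =
    ∈-++⁺ˡ (∈-map⁺ leaf (∈-++⁺ʳ (map pos φs) (∈-map⁺ neg α∈)))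
  ∈-structures {φs} (suc n) (X ∘ Y) XY≤ (x , y) =
    ∈-++⁺ʳ (leafStructures φs) (∈-++⁺ˡ
      (uncurry (∈-cartesianProductWith⁺ _∘_) (∈-structures² n X Y XY≤ x y)))
  ∈-structures {φs} (suc n) (X ⊸ Y) XY≤ (x , y) =
    ∈-++⁺ʳ (leafStructures φs) (∈-++⁺ʳ (joins _∘_ (structures φs n))
      (uncurry (∈-cartesianProductWith⁺ _⊸_) (∈-structures² n X Y XY≤ x y)))

  ∈-structures² : ∀ {φs} n X Y → weight X + weight Y ≤ suc n →
                  Leaves (_∈ φs) X → Leaves (_∈ φs) Y →
                  X ∈ structures φs n × Y ∈ structures φs n
  ∈-structures² n X Y XY≤ x y =
    ∈-structures n X (m+n≤1+o⇒m≤o (weight X) (weight-pos Y) XY≤) x ,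
    ∈-structures n Y (m+n≤1+o⇒n≤o (weight Y) (weight-pos X) XY≤) y

universe : Formula → ℕ → List Sequentᴰ
universe ρ w = cartesianProduct (structures (subformulas ρ) w) (structures (subformulas ρ) w)

good∈universe : ∀ {ρ w s} → Good ρ w s → s ∈ universe ρ w
good∈universe {s = X , Y} (XY≤w , x , y) = ∈-cartesianProduct⁺
  (∈-structures _ X (≤-trans (m≤m+n (weight X) (weight Y)) XY≤w)
                    (leaves-map ⊑⇒∈-subformulas X x))
  (∈-structures _ Y (≤-trans (m≤n+m (weight Y) (weight X)) XY≤w)
                    (leaves-map ⊑⇒∈-subformulas Y y))

corollary4 : (α β : Formula) → Dec (⊢ α ⇒ β)
corollary4 α β =
  map′ (λ (k , d) → ⊩⇒⊢ (derivable≤⇒provable k d)) (λ p → provable⇒derivable (⊢⇒⊩ p))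
       (derivable? (Good ρ w) (universe ρ w) good∈universe rules-good good)
  where
  -- α and β are both subformulas of α · β, so a single root bounds the leaves.
  ρ : Formula
  ρ = α · β

  w : ℕ
  w = size α + size β

  good : Good ρ w (leaf (pos α) , leaf (neg β))
  good = ≤-refl , ⊑·ˡ ⊑-refl , ⊑·ʳ ⊑-refl
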